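{- Let $q>2$ be a prime power and let $h(x):=1-x^{q-2}\in\mathbb{F}_q[x]$. Then the polynomial $g(x):=h(h(h(x)))$ induces on $\mathbb{F}_q$ the transposition $(0\,1)$, i.e. the permutation interchanging $0$ and $1$ and fixing every other element of $\mathbb{F}_q$. Consequently, for every $a\in\mathbb{F}_q^*$, the polynomial $a\,g(x/a)$ induces on $\mathbb{F}_q$ the transposition $(0\,a)$.
   Context: A polynomial $f\in\mathbb{F}_q[x]$ induces the map $\mathbb{F}_q\to\mathbb{F}_q$, $c\mapsto f(c)$. Here $x^{q-2}$ is the usual power (so $0^{q-2}=0$ since $q>2$). -}

module Defs where

open import Level using (_⊔_)
open import Data.Nat using (ℕ; zero; suc; _≥_; _^_)
open import Data.Nat.Primality using (Prime)
open import Data.Fin using (Fin)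
open import Data.Product using (∃; ∃-syntax; _×_; _,_; proj₁)
open import Relation.Nullary using (¬_)
open import Relation.Binary.PropositionalEquality using (_≡_)
import Relation.Binary.PropositionalEquality as ≡
open import Function.Bundles using (Inverse)
open import Algebra.Bundles using (CommutativeRing)

IsPrimePower : ℕ → Set
IsPrimePower q = ∃[ p ] ∃[ k ] (Prime p × k ≥ 1 × q ≡ p ^ k)

record IsFiniteField {c ℓ} (R : CommutativeRing c ℓ) (q : ℕ) : Set (c ⊔ ℓ) where
  open CommutativeRing R
  field
    0≉1     : ¬ (0# ≈ 1#)
    inverse : ∀ x → ¬ (x ≈ 0#) → ∃ λ y → x * y ≈ 1#
    card    : Inverse setoid (≡.setoid (Fin q))

module FieldOps {c ℓ} (R : CommutativeRing c ℓ) where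
  open CommutativeRing R

  -- usual power x^n with x^0 = 1 (so 0^n = 0 for n ≥ 1)
  pow : Carrier → ℕ → Carrier
  pow x zero    = 1#
  pow x (suc n) = x * pow x n

  -- the map induced by h(x) = 1 - x^(q-2)  (n = q - 2)
  hMap : ℕ → Carrier → Carrier
  hMap n x = 1# - pow x n

  gMap : ℕ → Carrier → Carrier
  gMap n x = hMap n (hMap n (hMap n x))

  InducesTransposition : (Carrier → Carrier) → Carrier → Carrier → Set (c ⊔ ℓ)
  InducesTransposition f u v =
    (f u ≈ v) × (f v ≈ u) × (∀ x → ¬ (x ≈ u) → ¬ (x ≈ v) → f x ≈ x)

module Submission where

-- Write n = q - 2 and h(x) = 1 - x^n.  The proof rests on Fermat's little
-- theorem: in a field with q elements every x ≠ 0 satisfies x^(q-1) = 1,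
-- so x^n is the inverse of x for x ≠ 0, while 0^n = 0 as n ≥ 1.  Hence h
-- acts as the Möbius map x ↦ (x - 1)/x off {0, 1}, with h(0) = 1, h(1) = 0,
-- and a direct computation gives h(h(x)) = -1/(x - 1), h(h(h(x))) = x.

open import Defs
open import Data.Nat using (ℕ; _<_; _∸_; zero; suc; s≤s)
open import Data.Product using (_×_; proj₁; proj₂; _,_)
open import Data.Fin using (Fin; zero; suc; punchIn)
open import Data.Fin.Properties using (_≟_; punchInᵢ≢i)
import Data.Fin.Permutation as Perm
open import Relation.Nullary using (¬_; Dec; yes; no; contradiction)
open import Relation.Binary.PropositionalEquality as ≡ using (_≡_; _≢_)
open import Function.Bundles using (Inverse)
open import Algebra.Bundles using (CommutativeRing)
import Algebra.Properties.Ring as RingProperties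
import Algebra.Properties.CommutativeMonoid.Sum as MonoidSum
import Relation.Binary.Reasoning.Setoid as SetoidReasoning

module RingFacts {c ℓ} (R : CommutativeRing c ℓ) where
  open CommutativeRing R hiding (zero)
  open FieldOps R
  open SetoidReasoning setoid

  inverse-unique : ∀ {x a b} → x * a ≈ 1# → x * b ≈ 1# → a ≈ b
  inverse-unique {x} {a} {b} xa≈1 xb≈1 = begin
    a            ≈⟨ *-identityʳ a ⟨
    a * 1#       ≈⟨ *-congˡ xb≈1 ⟨
    a * (x * b)  ≈⟨ *-assoc a x b ⟨
    (a * x) * b  ≈⟨ *-congʳ (*-comm a x) ⟩
    (x * a) * b  ≈⟨ *-congʳ xa≈1 ⟩
    1# * b       ≈⟨ *-identityˡ b ⟩
    b            ∎

  unscale : ∀ {a a'} → a * a' ≈ 1# → ∀ y → a * (y * a') ≈ y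
  unscale {a} {a'} aa'≈1 y = begin
    a * (y * a')  ≈⟨ *-congˡ (*-comm y a') ⟩
    a * (a' * y)  ≈⟨ *-assoc a a' y ⟨
    (a * a') * y  ≈⟨ *-congʳ aa'≈1 ⟩
    1# * y        ≈⟨ *-identityˡ y ⟩
    y             ∎

  pow-cong : ∀ {a b} → a ≈ b → ∀ j → pow a j ≈ pow b j
  pow-cong a≈b zero    = refl
  pow-cong a≈b (suc j) = *-cong a≈b (pow-cong a≈b j)

  pow-one : ∀ j → pow 1# j ≈ 1#
  pow-one zero    = refl
  pow-one (suc j) = trans (*-identityˡ _) (pow-one j)

  scaled-transposition : ∀ {f} → (∀ {x y} → x ≈ y → f x ≈ f y) →
    InducesTransposition f 0# 1# →
    ∀ {a a'} → a * a' ≈ 1# →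
    InducesTransposition (λ x → a * f (x * a')) 0# a
  scaled-transposition {f} f-cong (f0≈1 , f1≈0 , f-fixes) {a} {a'} aa'≈1 =
    zero↦a , a↦zero , fixes
    where
    zero↦a : a * f (0# * a') ≈ a
    zero↦a = trans (*-congˡ (trans (f-cong (zeroˡ a')) f0≈1)) (*-identityʳ a)

    a↦zero : a * f (a * a') ≈ 0#
    a↦zero = trans (*-congˡ (trans (f-cong aa'≈1) f1≈0)) (zeroʳ a)

    fixes : ∀ x → ¬ (x ≈ 0#) → ¬ (x ≈ a) → a * f (x * a') ≈ x
    fixes x x≉0 x≉a = trans (*-congˡ (f-fixes (x * a') y≉0 y≉1)) (unscale aa'≈1 x)
      where
      y≉0 : ¬ (x * a' ≈ 0#)
      y≉0 y≈0 = x≉0 (trans (sym (unscale aa'≈1 x)) (trans (*-congˡ y≈0) (zeroʳ a)))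
      y≉1 : ¬ (x * a' ≈ 1#)
      y≉1 y≈1 = x≉a (trans (sym (unscale aa'≈1 x)) (trans (*-congˡ y≈1) (*-identityʳ a)))

module FiniteField {c ℓ} (R : CommutativeRing c ℓ) {N : ℕ}
                   (F : IsFiniteField R (suc N)) where
  open CommutativeRing R hiding (zero)
  open FieldOps R
  open IsFiniteField F
  open RingFacts R
  open SetoidReasoning setoid
  module Card = Inverse card
  -- Products of Fin-indexed families: sums in the multiplicative monoid.
  module Π = MonoidSum *-commutativeMonoid

  product-of-nonzero : ∀ {a b} → ¬ (a ≈ 0#) → ¬ (b ≈ 0#) → ¬ (a * b ≈ 0#)
  product-of-nonzero {a} {b} a≉0 b≉0 ab≈0 = b≉0 (begin
    b             ≈⟨ *-identityˡ b ⟨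
    1# * b        ≈⟨ *-congʳ (trans (*-comm a' a) (proj₂ (inverse a a≉0))) ⟨
    (a' * a) * b  ≈⟨ *-assoc a' a b ⟩
    a' * (a * b)  ≈⟨ *-congˡ ab≈0 ⟩
    a' * 0#       ≈⟨ zeroʳ a' ⟩
    0#            ∎)
    where
    a' : Carrier
    a' = proj₁ (inverse a a≉0)

  cancel-nonzero : ∀ {a b} → ¬ (b ≈ 0#) → a * b ≈ b → a ≈ 1#
  cancel-nonzero {a} {b} b≉0 ab≈b = begin
    a              ≈⟨ *-identityʳ a ⟨
    a * 1#         ≈⟨ *-congˡ bb'≈1 ⟨
    a * (b * b')   ≈⟨ *-assoc a b b' ⟨
    (a * b) * b'   ≈⟨ *-congʳ ab≈b ⟩
    b * b'         ≈⟨ bb'≈1 ⟩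
    1#             ∎
    where
    b' : Carrier
    b' = proj₁ (inverse b b≉0)
    bb'≈1 : b * b' ≈ 1#
    bb'≈1 = proj₂ (inverse b b≉0)

  element : Fin (suc N) → Carrier
  element = Card.from

  element≈0⇒index0 : ∀ i → element i ≈ 0# → i ≡ Card.to 0#
  element≈0⇒index0 i eᵢ≈0 = ≡.trans (≡.sym (Card.strictlyInverseˡ i)) (Card.to-cong eᵢ≈0)

  -- Being zero is decidable, since equality in Fin is.
  zero? : ∀ y → Dec (y ≈ 0#)
  zero? y with Card.to y ≟ Card.to 0#
  ... | yes eq = yes (trans (sym (Card.strictlyInverseʳ y))
                            (trans (reflexive (≡.cong Card.from eq)) (Card.strictlyInverseʳ 0#)))
  ... | no ne  = no (λ y≈0 → ne (Card.to-cong y≈0))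

  ifZero : Carrier → Carrier → Carrier → Carrier
  ifZero y a b with zero? y
  ... | yes _ = a
  ... | no _  = b

  ifZero-yes : ∀ {y} a b → y ≈ 0# → ifZero y a b ≡ a
  ifZero-yes {y} a b y≈0 with zero? y
  ... | yes _  = ≡.refl
  ... | no y≉0 = contradiction y≈0 y≉0

  ifZero-no : ∀ {y} a b → ¬ (y ≈ 0#) → ifZero y a b ≡ b
  ifZero-no {y} a b y≉0 with zero? y
  ... | yes y≈0 = contradiction y≈0 y≉0
  ... | no _    = ≡.refl

  nonzeroPart : Carrier → Carrier
  nonzeroPart y = ifZero y 1# y

  nonzeroPart-nonzero : ∀ y → ¬ (nonzeroPart y ≈ 0#)
  nonzeroPart-nonzero y with zero? y
  ... | yes _  = λ 1≈0 → 0≉1 (sym 1≈0)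
  ... | no y≉0 = y≉0

  -- The multiplicative factor by which scaling y by x changes nonzeroPart y.
  scaleFactor : Carrier → Carrier → Carrier
  scaleFactor x y = ifZero y 1# x

  nonzeroPart-scale : ∀ {x} → ¬ (x ≈ 0#) → ∀ y →
    nonzeroPart (x * y) ≈ scaleFactor x y * nonzeroPart y
  nonzeroPart-scale {x} x≉0 y with zero? y
  ... | yes y≈0 = begin
    nonzeroPart (x * y)  ≡⟨ ifZero-yes 1# (x * y) (trans (*-congˡ y≈0) (zeroʳ x)) ⟩
    1#                   ≈⟨ *-identityˡ 1# ⟨
    1# * 1#              ∎
  ... | no y≉0 = reflexive (ifZero-no 1# (x * y) (product-of-nonzero x≉0 y≉0))

  nonzeroPart-cong : ∀ {a b} → a ≈ b → nonzeroPart a ≈ nonzeroPart b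
  nonzeroPart-cong {a} {b} a≈b with zero? a
  ... | yes a≈0 = reflexive (≡.sym (ifZero-yes 1# b (trans (sym a≈b) a≈0)))
  ... | no a≉0  = trans a≈b (reflexive (≡.sym (ifZero-no 1# b (λ b≈0 → a≉0 (trans a≈b b≈0)))))

  product-nonzero : ∀ {j} (v : Fin j → Carrier) → (∀ i → ¬ (v i ≈ 0#)) → ¬ (Π.sum v ≈ 0#)
  product-nonzero {zero}  v v≉0 1≈0 = 0≉1 (sym 1≈0)
  product-nonzero {suc j} v v≉0 =
    product-of-nonzero (v≉0 zero) (product-nonzero (λ i → v (suc i)) (λ i → v≉0 (suc i)))

  product-constant : ∀ {j} (v : Fin j → Carrier) {x} → (∀ i → v i ≈ x) → Π.sum v ≈ pow x j
  product-constant {zero}  v v≈x = refl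
  product-constant {suc j} v v≈x = *-cong (v≈x zero) (product-constant (λ i → v (suc i)) (λ i → v≈x (suc i)))

  product-all-but-one : ∀ {j} (v : Fin (suc j) → Carrier) (z : Fin (suc j)) {x} →
    v z ≈ 1# → (∀ i → i ≢ z → v i ≈ x) → Π.sum v ≈ pow x j
  product-all-but-one {j} v z {x} vz≈1 v≈x = begin
    Π.sum v                              ≈⟨ Π.sum-remove {i = z} v ⟩
    v z * Π.sum (λ i → v (punchIn z i))  ≈⟨ *-cong vz≈1 (product-constant _ (λ i → v≈x _ (punchInᵢ≢i z i))) ⟩
    1# * pow x j                         ≈⟨ *-identityˡ _ ⟩
    pow x j                              ∎

  fermat : ∀ x → ¬ (x ≈ 0#) → pow x N ≈ 1#
  fermat x x≉0 = cancel-nonzero P≉0 scaled-product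
    where
    x' : Carrier
    x' = proj₁ (inverse x x≉0)
    xx'≈1 : x * x' ≈ 1#
    xx'≈1 = proj₂ (inverse x x≉0)

    scaleIndex : Carrier → Fin (suc N) → Fin (suc N)
    scaleIndex a i = Card.to (a * element i)

    scaleIndex-cancel : ∀ {a b} → a * b ≈ 1# → ∀ i → scaleIndex a (scaleIndex b i) ≡ i
    scaleIndex-cancel {a} {b} ab≈1 i = ≡.trans (Card.to-cong (begin
      a * element (scaleIndex b i)  ≈⟨ *-congˡ (Card.strictlyInverseʳ _) ⟩
      a * (b * element i)           ≈⟨ *-assoc a b _ ⟨
      (a * b) * element i           ≈⟨ *-congʳ ab≈1 ⟩
      1# * element i                ≈⟨ *-identityˡ _ ⟩
      element i                     ∎)) (Card.strictlyInverseˡ i)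

    scaleByX : Perm.Permutation′ (suc N)
    scaleByX = Perm.permutation (scaleIndex x) (scaleIndex x')
      (scaleIndex-cancel xx'≈1) (scaleIndex-cancel (trans (*-comm x' x) xx'≈1))

    -- The product of all nonzero elements, with an extra factor 1 for 0.
    P : Carrier
    P = Π.sum (λ i → nonzeroPart (element i))

    P≉0 : ¬ (P ≈ 0#)
    P≉0 = product-nonzero (λ i → nonzeroPart (element i)) (λ i → nonzeroPart-nonzero (element i))

    -- Scaling changes every factor of P by x, except the one for 0.
    scaleFactors : Π.sum (λ i → scaleFactor x (element i)) ≈ pow x N
    scaleFactors = product-all-but-one (λ i → scaleFactor x (element i)) (Card.to 0#)
      (reflexive (ifZero-yes 1# x (Card.strictlyInverseʳ 0#)))
      (λ i i≢0 → reflexive (ifZero-no 1# x (λ eᵢ≈0 → i≢0 (element≈0⇒index0 i eᵢ≈0))))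

    -- Multiplication by x permutes the field, so it leaves P unchanged.
    scaled-product : pow x N * P ≈ P
    scaled-product = sym (begin
      P                                                      ≈⟨ Π.sum-permute (λ i → nonzeroPart (element i)) scaleByX ⟩
      Π.sum (λ i → nonzeroPart (element (scaleIndex x i)))   ≈⟨ Π.sum-cong-≋ (λ i → nonzeroPart-cong (Card.strictlyInverseʳ (x * element i))) ⟩
      Π.sum (λ i → nonzeroPart (x * element i))              ≈⟨ Π.sum-cong-≋ (λ i → nonzeroPart-scale x≉0 (element i)) ⟩
      Π.sum (λ i → scaleFactor x (element i) * nonzeroPart (element i))
                                                             ≈⟨ Π.∑-distrib-+ (λ i → scaleFactor x (element i)) (λ i → nonzeroPart (element i)) ⟩
      Π.sum (λ i → scaleFactor x (element i)) * P            ≈⟨ *-congʳ scaleFactors ⟩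
      pow x N * P                                            ∎)

module PowerInversion {c ℓ} (R : CommutativeRing c ℓ) (k : ℕ) where
  open CommutativeRing R hiding (zero)
  open FieldOps R
  open RingFacts R
  open RingProperties ring
  open SetoidReasoning setoid

  n : ℕ
  n = suc k

  h-cong : ∀ {a b} → a ≈ b → hMap n a ≈ hMap n b
  h-cong a≈b = +-congˡ (-‿cong (pow-cong a≈b n))

  g-cong : ∀ {a b} → a ≈ b → gMap n a ≈ gMap n b
  g-cong a≈b = h-cong (h-cong (h-cong a≈b))

  h-zero : hMap n 0# ≈ 1#
  h-zero = begin
    1# - 0# * pow 0# k  ≈⟨ +-congˡ (-‿cong (zeroˡ _)) ⟩
    1# - 0#             ≈⟨ +-congˡ -0#≈0# ⟩
    1# + 0#             ≈⟨ +-identityʳ 1# ⟩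
    1#                  ∎

  h-one : hMap n 1# ≈ 0#
  h-one = trans (+-congˡ (-‿cong (pow-one n))) (-‿inverseʳ 1#)

  g-zero : gMap n 0# ≈ 1#
  g-zero = trans (h-cong (h-cong h-zero)) (trans (h-cong h-one) h-zero)

  g-one : gMap n 1# ≈ 0#
  g-one = trans (h-cong (h-cong h-one)) (trans (h-cong h-zero) h-one)

  module _ (0≉1 : ¬ (0# ≈ 1#)) (inverts : ∀ x → ¬ (x ≈ 0#) → x * pow x n ≈ 1#) where

    pow-inverse : ∀ {y w} → y * w ≈ 1# → pow y n ≈ w
    pow-inverse {y} {w} yw≈1 = inverse-unique (inverts y y≉0) yw≈1
      where
      y≉0 : ¬ (y ≈ 0#)
      y≉0 y≈0 = 0≉1 (trans (sym (zeroˡ w)) (trans (*-congʳ (sym y≈0)) yw≈1))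

    -- Off {0, 1}, h(x) = (x - 1)/x, h(h(x)) = -1/(x - 1) and h(h(h(x))) = x.
    g-fixes : ∀ x → ¬ (x ≈ 0#) → ¬ (x ≈ 1#) → gMap n x ≈ x
    g-fixes x x≉0 x≉1 = begin
      hMap n (hMap n y)  ≈⟨ h-cong hy≈-j ⟩
      1# - pow (- j) n   ≈⟨ +-congˡ (-‿cong (pow-inverse -j-u≈1)) ⟩
      1# - - u           ≈⟨ +-congˡ (-‿involutive u) ⟩
      1# + u             ≈⟨ +-comm 1# u ⟩
      (x - 1#) + 1#      ≈⟨ //-rightDividesˡ 1# x ⟩
      x                  ∎
      where
      y u j : Carrier
      y = hMap n x
      u = x - 1#
      j = pow u n

      yx≈u : y * x ≈ u
      yx≈u = begin
        (1# - pow x n) * x       ≈⟨ [y-z]x≈yx-zx x 1# (pow x n) ⟩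
        1# * x - pow x n * x     ≈⟨ +-cong (*-identityˡ x) (-‿cong (trans (*-comm _ x) (inverts x x≉0))) ⟩
        u                        ∎

      uj≈1 : u * j ≈ 1#
      uj≈1 = inverts u (λ u≈0 → x≉1 (x∙y⁻¹≈ε⇒x≈y x 1# u≈0))

      -- h(x)^n = x/(x - 1), hence h(h(x)) = 1 - x/(x - 1) = -1/(x - 1)
      hy≈-j : hMap n y ≈ - j
      hy≈-j = begin
        1# - pow y n             ≈⟨ +-congˡ (-‿cong (pow-inverse yxj≈1)) ⟩
        1# - x * j               ≈⟨ +-congʳ xj-j≈1 ⟨
        (x * j - j) - x * j      ≈⟨ xyx⁻¹≈y (x * j) (- j) ⟩
        - j                      ∎
        where
        yxj≈1 : y * (x * j) ≈ 1#
        yxj≈1 = trans (sym (*-assoc y x j)) (trans (*-congʳ yx≈u) uj≈1)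
        xj-j≈1 : x * j - j ≈ 1#
        xj-j≈1 = begin
          x * j - j          ≈⟨ +-congˡ (-1*x≈-x j) ⟨
          x * j + - 1# * j   ≈⟨ distribʳ j x (- 1#) ⟨
          u * j              ≈⟨ uj≈1 ⟩
          1#                 ∎

      -j-u≈1 : - j * - u ≈ 1#
      -j-u≈1 = begin
        - j * - u      ≈⟨ -‿distribˡ-* j (- u) ⟨
        - (j * - u)    ≈⟨ -‿cong (-‿distribʳ-* j u) ⟨
        - - (j * u)    ≈⟨ -‿involutive _ ⟩
        j * u          ≈⟨ *-comm j u ⟩
        u * j          ≈⟨ uj≈1 ⟩
        1#             ∎

    g-swaps : InducesTransposition (gMap n) 0# 1#
    g-swaps = g-zero , g-one , g-fixes

mainTheorem1 : ∀ {c ℓ} (R : CommutativeRing c ℓ) (q : ℕ) →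
    IsPrimePower q → 2 < q → (F : IsFiniteField R q) →
    let open CommutativeRing R
        open FieldOps R
        open IsFiniteField F
    in InducesTransposition (gMap (q ∸ 2)) 0# 1#
       × (∀ (a : Carrier) (a≉0 : ¬ (a ≈ 0#)) →
            InducesTransposition
              (λ x → a * gMap (q ∸ 2) (x * proj₁ (inverse a a≉0))) 0# a)
mainTheorem1 R (suc zero) _ (s≤s ()) F
mainTheorem1 R (suc (suc zero)) _ (s≤s (s≤s ())) F
mainTheorem1 R (suc (suc (suc k))) _ _ F =
  g-swaps 0≉1 fermat ,
  λ a a≉0 → scaled-transposition g-cong (g-swaps 0≉1 fermat) (proj₂ (inverse a a≉0))
  where
  open IsFiniteField F
  open RingFacts R using (scaled-transposition)
  open FiniteField R F using (fermat)
  open PowerInversion R k using (g-cong; g-swaps)
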